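{- Let $G$ be a permutation graph with a fixed permutation diagram, and let $S$ be a convexly independent set of $G$. Then each connected component of the induced subgraph $G[S]$ is either a single vertex or a single edge. Moreover, the components of $G[S]$ are linearly ordered from left to right in the diagram: for any two distinct components $C,D$ of $G[S]$, either all endpoints of segments of $C$ lie to the left of all endpoints of segments of $D$ on each of the two lines, or vice versa.
   Context: All graphs are finite and simple. A permutation diagram of $G$ is a representation of $G$ as the intersection graph of straight line segments, one per vertex, each having one endpoint on a top horizontal line and one on a bottom horizontal line (all endpoints distinct); two vertices are adjacent iff their segments cross. A set $C$ of vertices is ($P_3$-)convex if every vertex outside $C$ has at most one neighbor in $C$; $\sigma(A)$ is the smallest convex set containing $A$. A set $S$ is convexly independent if $y\notin\sigma(S\setminus\{y\})$ for all $y\in S$. -}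

module Defs where

open import Level using (0ℓ)
open import Data.Nat using (ℕ; _<_)
open import Data.Fin using (Fin)
open import Data.Fin.Subset using (Subset; _∈_; _∉_)
open import Data.Product using (_×_; Σ; ∃; _,_)
open import Data.Sum using (_⊎_)
open import Data.Empty using (⊥)
open import Relation.Nullary using (¬_)
open import Relation.Binary.PropositionalEquality using (_≡_; _≢_)
open import Function.Definitions using (Injective)

-- A permutation diagram on n segments (vertices Fin n): vertex v is the
-- segment from position top v on the top line to position bottom v on the
-- bottom line.
record Diagram (n : ℕ) : Set where
  field
    top       : Fin n → ℕ
    bottom    : Fin n → ℕ
    top-inj    : Injective _≡_ _≡_ top
    bottom-inj : Injective _≡_ _≡_ bottom

open Diagram public

-- The permutation graph of the diagram: u ~ v iff their segments cross.
Adj : ∀ {n} → Diagram n → Fin n → Fin n → Set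
Adj D u v = (top D u < top D v × bottom D v < bottom D u)
          ⊎ (top D v < top D u × bottom D u < bottom D v)

-- C is (P3-)convex: every vertex outside C has at most one neighbour in C.
Convex : ∀ {n} → Diagram n → Subset n → Set
Convex D C = ∀ v → v ∉ C → ∀ u w → u ∈ C → w ∈ C →
             Adj D v u → Adj D v w → u ≡ w

InHull : ∀ {n} → Diagram n → (Fin n → Set) → Fin n → Set
InHull {n} D A y = ∀ (C : Subset n) → Convex D C → (∀ x → A x → x ∈ C) → y ∈ C

ConvexlyIndependent : ∀ {n} → Diagram n → Subset n → Set
ConvexlyIndependent D S =
  ∀ y → y ∈ S → ¬ InHull D (λ x → x ∈ S × x ≢ y) y

data Reach {n} (D : Diagram n) (S : Subset n) (u : Fin n) : Fin n → Set where
  here : u ∈ S → Reach D S u u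
  step : ∀ {w v} → Reach D S u w → v ∈ S → Adj D w v → Reach D S u v

SmallComponent : ∀ {n} → Diagram n → Subset n → Fin n → Set
SmallComponent D S u =
    (∀ w → Reach D S u w → w ≡ u)
  ⊎ (Σ (Fin _) λ v → u ≢ v × Adj D u v × Reach D S u v ×
        (∀ w → Reach D S u w → w ≡ u ⊎ w ≡ v))

LeftOf : ∀ {n} → Diagram n → Subset n → Fin n → Fin n → Set
LeftOf D S u v = ∀ x y → Reach D S u x → Reach D S v y →
                 top D x < top D y × bottom D x < bottom D y

-- A vertex y with two distinct neighbours a, c lies in every convex set
-- containing a and c, so in a convexly independent S no vertex has two
-- neighbours inside S: the components of G[S] are vertices and edges.
-- The ordering needs no convexity at all: two distinct non-crossing segments
-- lie one strictly left of the other, and a segment that crosses a segment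
-- left of b, but not b itself, is again left of b.  Following paths of G[S]
-- on both sides spreads "u is left of v" to the whole components.
module Submission where

open import Defs
open import Data.Nat using (_<_)
open import Data.Nat.Properties using (<-cmp; <-irrefl; <-trans; <-asym; _<?_)
open import Data.Fin using (Fin; _≟_)
open import Data.Fin.Subset using (Subset; _∈_)
open import Data.Fin.Subset.Properties using (_∈?_)
open import Data.Fin.Properties using (any?)
open import Data.Product using (_×_; _,_)
open import Data.Sum using (_⊎_; inj₁; inj₂)
open import Data.Empty using (⊥-elim)
open import Relation.Nullary using (¬_; Dec; yes; no)
open import Relation.Nullary.Decidable using (_×-dec_; _⊎-dec_)
open import Relation.Binary using (tri<; tri≈; tri>)
open import Relation.Binary.PropositionalEquality using (_≡_; _≢_; refl; ≢-sym)

module _ {n} (D : Diagram n) where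

  SegLeft : Fin n → Fin n → Set
  SegLeft a b = top D a < top D b × bottom D a < bottom D b

  SegLeft-trans : ∀ {a b c} → SegLeft a b → SegLeft b c → SegLeft a c
  SegLeft-trans (t , b) (t′ , b′) = <-trans t t′ , <-trans b b′

  Adj-sym : ∀ {a b} → Adj D a b → Adj D b a
  Adj-sym (inj₁ p) = inj₂ p
  Adj-sym (inj₂ p) = inj₁ p

  Adj⇒≢ : ∀ {a b} → Adj D a b → a ≢ b
  Adj⇒≢ (inj₁ (p , _)) refl = <-irrefl refl p
  Adj⇒≢ (inj₂ (p , _)) refl = <-irrefl refl p

  Adj? : ∀ a b → Dec (Adj D a b)
  Adj? a b = ((top D a <? top D b) ×-dec (bottom D b <? bottom D a))
           ⊎-dec ((top D b <? top D a) ×-dec (bottom D a <? bottom D b))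

  SegLeft⇒¬Adj : ∀ {a b} → SegLeft a b → ¬ Adj D a b
  SegLeft⇒¬Adj (_ , b) (inj₁ (_ , q)) = <-asym b q
  SegLeft⇒¬Adj (t , _) (inj₂ (p , _)) = <-asym t p

  ¬Adj⇒SegLeft⊎SegLeft : ∀ {a b} → a ≢ b → ¬ Adj D a b → SegLeft a b ⊎ SegLeft b a
  ¬Adj⇒SegLeft⊎SegLeft {a} {b} a≢b ¬ab
    with <-cmp (top D a) (top D b) | <-cmp (bottom D a) (bottom D b)
  ... | tri≈ _ e _ | _          = ⊥-elim (a≢b (top-inj D e))
  ... | _          | tri≈ _ e _ = ⊥-elim (a≢b (bottom-inj D e))
  ... | tri< t _ _ | tri< q _ _ = inj₁ (t , q)
  ... | tri< t _ _ | tri> _ _ q = ⊥-elim (¬ab (inj₁ (t , q)))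
  ... | tri> _ _ t | tri< q _ _ = ⊥-elim (¬ab (inj₂ (t , q)))
  ... | tri> _ _ t | tri> _ _ q = inj₂ (t , q)

  SegLeft-crossˡ : ∀ {a a′ b} → SegLeft a b → Adj D a a′ →
                   a′ ≢ b → ¬ Adj D a′ b → SegLeft a′ b
  SegLeft-crossˡ ab aa′ a′≢b ¬a′b with ¬Adj⇒SegLeft⊎SegLeft a′≢b ¬a′b
  ... | inj₁ a′b = a′b
  ... | inj₂ ba′ = ⊥-elim (SegLeft⇒¬Adj (SegLeft-trans ab ba′) aa′)

  SegLeft-crossʳ : ∀ {a b b′} → SegLeft a b → Adj D b b′ →
                   a ≢ b′ → ¬ Adj D a b′ → SegLeft a b′
  SegLeft-crossʳ ab bb′ a≢b′ ¬ab′ with ¬Adj⇒SegLeft⊎SegLeft a≢b′ ¬ab′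
  ... | inj₁ ab′ = ab′
  ... | inj₂ b′a = ⊥-elim (SegLeft⇒¬Adj (SegLeft-trans b′a ab) (Adj-sym bb′))

  twoNeighbours⇒InHull : ∀ (A : Fin n → Set) {y a c} → A a → A c → a ≢ c →
                         Adj D y a → Adj D y c → InHull D A y
  twoNeighbours⇒InHull A Aa Ac a≢c ya yc C convex A⊆C with _ ∈? C
  ... | yes y∈C = y∈C
  ... | no  y∉C = ⊥-elim (a≢c (convex _ y∉C _ _ (A⊆C _ Aa) (A⊆C _ Ac) ya yc))

  module _ (S : Subset n) where

    Reach⇒∈ : ∀ {u v} → Reach D S u v → v ∈ S
    Reach⇒∈ (here v∈S)     = v∈S
    Reach⇒∈ (step _ v∈S _) = v∈S

    Reach-trans : ∀ {u w v} → Reach D S u w → Reach D S w v → Reach D S u v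
    Reach-trans r (here _)        = r
    Reach-trans r (step r′ v∈S a) = step (Reach-trans r r′) v∈S a

    Reach-sym : ∀ {u v} → Reach D S u v → Reach D S v u
    Reach-sym (here u∈S)     = here u∈S
    Reach-sym (step r v∈S a) = Reach-trans (step (here v∈S) (Reach⇒∈ r) (Adj-sym a)) (Reach-sym r)

    module _ {u v} (u∈S : u ∈ S) (¬uv : ¬ Reach D S u v) where

      private
        distinct : ∀ {x y} → Reach D S u x → Reach D S v y → x ≢ y
        distinct ux vy refl = ¬uv (Reach-trans ux (Reach-sym vy))

        nonadjacent : ∀ {x y} → Reach D S u x → Reach D S v y → ¬ Adj D x y
        nonadjacent ux vy xy = ¬uv (Reach-trans (step ux (Reach⇒∈ vy) xy) (Reach-sym vy))

        SegLeft-fromˡ : SegLeft u v → ∀ {y} → Reach D S v y → SegLeft u y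
        SegLeft-fromˡ uv (here _) = uv
        SegLeft-fromˡ uv (step vw y∈S wy) =
          SegLeft-crossʳ (SegLeft-fromˡ uv vw) wy (distinct (here u∈S) vy) (nonadjacent (here u∈S) vy)
          where vy = step vw y∈S wy

      SegLeft⇒LeftOf : SegLeft u v → LeftOf D S u v
      SegLeft⇒LeftOf uv x y (here _) vy = SegLeft-fromˡ uv vy
      SegLeft⇒LeftOf uv x y (step uw x∈S wx) vy =
        SegLeft-crossˡ (SegLeft⇒LeftOf uv _ y uw vy) wx (distinct ux vy) (nonadjacent ux vy)
        where ux = step uw x∈S wx

    components-ordered : ∀ u v → u ∈ S → v ∈ S → ¬ Reach D S u v →
                         LeftOf D S u v ⊎ LeftOf D S v u
    components-ordered u v u∈S v∈S ¬uv
      with ¬Adj⇒SegLeft⊎SegLeft (λ { refl → ¬uv (here u∈S) }) (λ uv → ¬uv (step (here u∈S) v∈S uv))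
    ... | inj₁ uv = inj₁ (SegLeft⇒LeftOf u∈S ¬uv uv)
    ... | inj₂ vu = inj₂ (SegLeft⇒LeftOf v∈S (λ vu → ¬uv (Reach-sym vu)) vu)

    AtMostOneNeighbourIn : Set
    AtMostOneNeighbourIn = ∀ {y a c} → y ∈ S → a ∈ S → c ∈ S → Adj D y a → Adj D y c → a ≡ c

    ConvexlyIndependent⇒AtMostOneNeighbourIn : ConvexlyIndependent D S → AtMostOneNeighbourIn
    ConvexlyIndependent⇒AtMostOneNeighbourIn indep {y} {a} {c} y∈S a∈S c∈S ya yc with a ≟ c
    ... | yes a≡c = a≡c
    ... | no  a≢c = ⊥-elim (indep y y∈S
            (twoNeighbours⇒InHull _ (a∈S , ≢-sym (Adj⇒≢ ya)) (c∈S , ≢-sym (Adj⇒≢ yc)) a≢c ya yc))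

    AtMostOneNeighbourIn⇒SmallComponent : AtMostOneNeighbourIn → ∀ u → u ∈ S → SmallComponent D S u
    AtMostOneNeighbourIn⇒SmallComponent unique u u∈S with any? (λ v → (v ∈? S) ×-dec Adj? u v)
    ... | no  isolated = inj₁ stays
      where
      stays : ∀ w → Reach D S u w → w ≡ u
      stays w (here _) = refl
      stays w (step uw′ w∈S w′w) with stays _ uw′
      ... | refl = ⊥-elim (isolated (w , w∈S , w′w))
    ... | yes (v , v∈S , uv) = inj₂ (v , Adj⇒≢ uv , uv , step (here u∈S) v∈S uv , onEdge)
      where
      onEdge : ∀ w → Reach D S u w → w ≡ u ⊎ w ≡ v
      onEdge w (here _) = inj₁ refl
      onEdge w (step uw′ w∈S w′w) with onEdge _ uw′
      ... | inj₁ refl = inj₂ (unique u∈S w∈S v∈S w′w uv)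
      ... | inj₂ refl = inj₁ (unique v∈S w∈S u∈S w′w (Adj-sym uv))

mainTheorem6 : ∀ {n} (D : Diagram n) (S : Subset n) →
    ConvexlyIndependent D S →
    (∀ u → u ∈ S → SmallComponent D S u) ×
    (∀ u v → u ∈ S → v ∈ S → ¬ Reach D S u v →
      LeftOf D S u v ⊎ LeftOf D S v u)
mainTheorem6 D S indep =
  AtMostOneNeighbourIn⇒SmallComponent D S (ConvexlyIndependent⇒AtMostOneNeighbourIn D S indep) ,
  components-ordered D S
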